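{- Let $I$ be an institution with a skolemization $\langle I,S,(\mathcal I_\Sigma)_{\Sigma\in|\mathit{Sig}^I|},(\tau_\Sigma)_{\Sigma\in|\mathit{Sig}^I|}\rangle$, where $S(\Sigma,M)=\langle(\Sigma_S,S_\Sigma),M_{S\Sigma}\rangle$. Let $J$ be an institution and $\langle\phi,\alpha,\beta\rangle:J\to I$ an institution morphism such that: (1) $\phi:\mathit{Sig}^J\to\mathit{Sig}^I$ is fully faithful; (2) for each $\Sigma\in|\mathit{Sig}^J|$ there is $\tilde\Sigma\in|\mathit{Sig}^J|$ and an isomorphism $i_{\phi\Sigma}:\phi(\tilde\Sigma)\to(\phi\Sigma)_S$ in $\mathit{Sig}^I$; (3) each $\beta_\Sigma:\mathit{Mod}^J(\Sigma)\to\mathit{Mod}^I(\phi\Sigma)$ is an isomorphism of categories; (4) each $\alpha_\Sigma$ is semantically surjective, i.e. for every $\varphi\in\mathit{Sen}^J(\Sigma)$ there is $\psi\in\alpha_\Sigma[\mathit{Sen}^I(\phi\Sigma)]$ with $\varphi^*=\psi^*$. Then $J$ has a skolemization $\langle J,S',(\mathcal I'_\Sigma)_{\Sigma\in|\mathit{Sig}^J|},(\tau'_\Sigma)_{\Sigma\in|\mathit{Sig}^J|}\rangle$ in which, for each $\Sigma$: the skolem signature of $\Sigma$ is $\tilde\Sigma$; $\tau'_\Sigma:\Sigma\to\tilde\Sigma$ is the unique arrow with $\phi(\tau'_\Sigma)=i_{\phi\Sigma}^{ -1}\circ\tau_{\phi\Sigma}$; and if $\mathcal I_{\phi\Sigma}=\langle\mathcal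 U,\mathcal E\rangle$ then $\mathcal I'_\Sigma=\langle\mathcal U',\mathcal E'\rangle$, where $\mathcal U'$ and $\mathcal E'$ are the images of $\mathcal U$ and $\mathcal E$ under the functor $\beta_{\tilde\Sigma}^{ -1}\circ\mathit{Mod}^I(i_{\phi\Sigma}):\mathit{Mod}^I((\phi\Sigma)_S)\to\mathit{Mod}^J(\tilde\Sigma)$.
   Context: An institution $\langle\mathit{Sig},\mathit{Sen},\mathit{Mod},\models\rangle$: a category $\mathit{Sig}$, functors $\mathit{Sen}:\mathit{Sig}\to\mathbf{Set}$, $\mathit{Mod}:\mathit{Sig}^{op}\to\mathbf{Cat}$, and relations $\models_\Sigma\subseteq|\mathit{Mod}(\Sigma)|\times\mathit{Sen}(\Sigma)$ with $M'\models_{\Sigma'}\mathit{Sen}(h)(\phi)$ iff $\mathit{Mod}(h)(M')\models_\Sigma\phi$ for all $h:\Sigma\to\Sigma'$. Write $M\restriction_h=\mathit{Mod}(h)(M)$; for a model $M$, $M^*=\{\varphi: M\models\varphi\}$; for a sentence $\varphi$, $\varphi^*$ is the class of models satisfying it. An institution morphism $\langle\phi,\alpha,\beta\rangle:J\to I$: a functor $\phi:\mathit{Sig}^J\to\mathit{Sig}^I$, natural transformations $\alpha:\mathit{Sen}^I\circ\phi\Rightarrow\mathit{Sen}^J$, $\beta:\mathit{Mod}^J\Rightarrow\mathit{Mod}^I\circ\phi^{op}$, with $m\models^J_\Sigma\alpha_\Sigma(\psi)$ iff $\beta_\Sigma(m)\models^I_{\phi\Sigma}\psi$. The Grothendieck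 category $\mathit{Mod}^\sharp$ has objects $(\Sigma,M)$ with $M\in|\mathit{Mod}(\Sigma)|$ and arrows $(f,u):(\Sigma,M)\to(\Sigma',N)$ with $f:\Sigma\to\Sigma'$ and $u:M\to N\restriction_f$ in $\mathit{Mod}(\Sigma)$, composed by $(g,v)\circ(f,u)=(g\circ f,\mathit{Mod}(f)(v)\circ u)$. $\mathbb{P}res$ is the category of presentations $(\Sigma,E)$, $E\subseteq\mathit{Sen}(\Sigma)$, with arrows $f:\Sigma\to\Sigma'$ such that $\mathit{Sen}(f)(E)\subseteq E'$; $\mathit{Mod}^{\mathbb{P}res}(\Sigma,E)$ is the full subcategory of $\mathit{Mod}(\Sigma)$ of models satisfying all of $E$, with reducts inherited from $\mathit{Mod}$. An inclusion system on a category $\mathcal C$ is a pair $\langle\mathcal U,\mathcal E\rangle$ of broad subcategories of $\mathcal C$ such that $\mathcal U$ is a partial order and every arrow of $\mathcal C$ factors uniquely as an arrow of $\mathcal E$ followed by an arrow of $\mathcal U$; arrows of $\mathcal U$ are written $M\hookrightarrow N$. A skolemization of an institution $I$ is a tuple $\langle I,S,(\mathcal I_\Sigma)_{\Sigma},(\tau_\Sigma)_{\Sigma}\rangle$ where: $S:\mathit{Mod}^\sharp\to(\mathit{Mod}^{\mathbb{P}res})^\sharp$ is a functor sending $(\Sigma,M)$ to $((\Sigma_S,S_\Sigma),M_{S\Sigma})$ (the presentation $(\Sigma_S,S_\Sigma)$ depending only on $\Sigma$); for each $\Sigma$, $\tau_\Sigma:\Sigma\to\Sigma_S$ is an arrow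 of $\mathit{Sig}$ with $M_{S\Sigma}\restriction_{\tau_\Sigma}=M$ for all $M\in|\mathit{Mod}(\Sigma)|$; a $\Sigma_S$-model $M'$ is called a skolemization of the $\Sigma$-model $M$ if $M'\restriction_{\tau_\Sigma}=M$ and $M'\models S_\Sigma$; and $\mathcal I_\Sigma$ is an inclusion system on $\mathit{Mod}(\Sigma_S)$ such that whenever $M',N'$ are skolemizations of $M,N$ respectively and $M'\hookrightarrow N'$, then $M^*=N^*$. -}

module Defs where

open import Level using (Level; _⊔_) renaming (suc to lsuc)
open import Data.Product using (Σ; Σ-syntax; ∃; ∃-syntax; _×_; _,_; proj₁; proj₂)
open import Function.Bundles using (_⇔_)
open import Relation.Binary.PropositionalEquality using (_≡_; refl; sym; subst)

-- Strict categories (arrow equality is propositional equality)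

record Category (ℓ : Level) : Set (lsuc ℓ) where
  infixr 9 _∘_
  field
    Obj : Set ℓ
    Hom : Obj → Obj → Set ℓ
    id  : ∀ {A} → Hom A A
    _∘_ : ∀ {A B C} → Hom B C → Hom A B → Hom A C
    identityˡ : ∀ {A B} {f : Hom A B} → id ∘ f ≡ f
    identityʳ : ∀ {A B} {f : Hom A B} → f ∘ id ≡ f
    assoc : ∀ {A B C D} {f : Hom A B} {g : Hom B C} {h : Hom C D} →
            (h ∘ g) ∘ f ≡ h ∘ (g ∘ f)

  Arr : Set ℓ
  Arr = Σ[ A ∈ Obj ] Σ[ B ∈ Obj ] Hom A B

  tot : ∀ {A B} → Hom A B → Arr
  tot {A} {B} f = A , B , f

open Category

record Iso {ℓ} (C : Category ℓ) (A B : Obj C) : Set ℓ where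
  field
    to   : Hom C A B
    from : Hom C B A
    from∘to : _∘_ C from to ≡ id C
    to∘from : _∘_ C to from ≡ id C
open Iso public

record Functor {ℓ} (C D : Category ℓ) : Set ℓ where
  field
    F₀ : Obj C → Obj D
    F₁ : ∀ {A B} → Hom C A B → Hom D (F₀ A) (F₀ B)
    F-id : ∀ {A} → F₁ (id C {A}) ≡ id D
    F-∘  : ∀ {A B E} {f : Hom C A B} {g : Hom C B E} →
           F₁ (_∘_ C g f) ≡ _∘_ D (F₁ g) (F₁ f)
open Functor public

IdF : ∀ {ℓ} (C : Category ℓ) → Functor C C
IdF C = record { F₀ = λ A → A ; F₁ = λ f → f ; F-id = refl ; F-∘ = refl }

_∘F_ : ∀ {ℓ} {C D E : Category ℓ} → Functor D E → Functor C D → Functor C E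
_∘F_ {C = C} {D} {E} G F = record
  { F₀ = λ A → F₀ G (F₀ F A)
  ; F₁ = λ f → F₁ G (F₁ F f)
  ; F-id = helper-id
  ; F-∘ = helper-∘ }
  where
    helper-id : ∀ {A} → F₁ G (F₁ F (id C {A})) ≡ id E
    helper-id {A} rewrite F-id F {A} = F-id G
    helper-∘ : ∀ {A B X} {f : Hom C A B} {g : Hom C B X} →
               F₁ G (F₁ F (_∘_ C g f)) ≡ _∘_ E (F₁ G (F₁ F g)) (F₁ G (F₁ F f))
    helper-∘ {f = f} {g} rewrite F-∘ F {f = f} {g} = F-∘ G

record _≈F_ {ℓ} {C D : Category ℓ} (F G : Functor C D) : Set ℓ where
  field
    obj-eq : ∀ A → F₀ F A ≡ F₀ G A
    arr-eq : ∀ {A B} (f : Hom C A B) → tot D (F₁ F f) ≡ tot D (F₁ G f)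
open _≈F_ public

FullyFaithful : ∀ {ℓ} {C D : Category ℓ} → Functor C D → Set ℓ
FullyFaithful {C = C} {D} F =
  (∀ {A B} (g : Hom D (F₀ F A) (F₀ F B)) → ∃[ f ] F₁ F f ≡ g) ×
  (∀ {A B} (f g : Hom C A B) → F₁ F f ≡ F₁ F g → f ≡ g)

IsInverseF : ∀ {ℓ} {C D : Category ℓ} → Functor C D → Functor D C → Set ℓ
IsInverseF {C = C} {D} F G = ((G ∘F F) ≈F IdF C) × ((F ∘F G) ≈F IdF D)

ArrPred : ∀ {ℓ} → Category ℓ → Set (lsuc ℓ)
ArrPred {ℓ} C = ∀ {A B} → Hom C A B → Set ℓ

IsBroadSub : ∀ {ℓ} (C : Category ℓ) → ArrPred C → Set ℓ
IsBroadSub C P =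
  (∀ {A} → P (id C {A})) ×
  (∀ {A B X} {f : Hom C A B} {g : Hom C B X} → P f → P g → P (_∘_ C g f))

IsPartialOrderSub : ∀ {ℓ} (C : Category ℓ) → ArrPred C → Set ℓ
IsPartialOrderSub C P =
  (∀ {A B} (f g : Hom C A B) → P f → P g → f ≡ g) ×
  (∀ {A B} (f : Hom C A B) (g : Hom C B A) → P f → P g → A ≡ B)

record InclusionSystem {ℓ} (C : Category ℓ) : Set (lsuc ℓ) where
  field
    isU : ArrPred C
    isE : ArrPred C
    U-sub : IsBroadSub C isU
    E-sub : IsBroadSub C isE
    U-po  : IsPartialOrderSub C isU
    factor : ∀ {A B} (f : Hom C A B) →
             Σ[ X ∈ Obj C ] Σ[ e ∈ Hom C A X ] Σ[ m ∈ Hom C X B ]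
               (isE e × isU m × _∘_ C m e ≡ f)
    factor-unique : ∀ {A B} (f : Hom C A B)
             (X : Obj C) (e : Hom C A X) (m : Hom C X B) →
             isE e → isU m → _∘_ C m e ≡ f →
             (X' : Obj C) (e' : Hom C A X') (m' : Hom C X' B) →
             isE e' → isU m' → _∘_ C m' e' ≡ f →
             _≡_ {A = Σ[ Y ∈ Obj C ] (Hom C A Y × Hom C Y B)} (X , e , m) (X' , e' , m')
open InclusionSystem public

ImageArr : ∀ {ℓ} {C D : Category ℓ} → Functor C D → ArrPred C → ArrPred D
ImageArr {C = C} {D} F P {A'} {B'} g =
  Σ[ A ∈ Obj C ] Σ[ B ∈ Obj C ] Σ[ f ∈ Hom C A B ]
    (P f × tot D (F₁ F f) ≡ tot D g)

SameArr : ∀ {ℓ} {C : Category ℓ} → ArrPred C → ArrPred C → Set ℓ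
SameArr {C = C} P Q = ∀ {A B} (f : Hom C A B) → P f ⇔ Q f

record Institution (ℓ : Level) : Set (lsuc ℓ) where
  field
    Sig : Category ℓ
    Sen  : Obj Sig → Set ℓ
    Sen₁ : ∀ {Σ Σ'} → Hom Sig Σ Σ' → Sen Σ → Sen Σ'
    Sen-id : ∀ {Σ} (φ : Sen Σ) → Sen₁ (id Sig) φ ≡ φ
    Sen-∘  : ∀ {Σ₁ Σ₂ Σ₃} (f : Hom Sig Σ₁ Σ₂) (g : Hom Sig Σ₂ Σ₃) (φ : Sen Σ₁) →
             Sen₁ (_∘_ Sig g f) φ ≡ Sen₁ g (Sen₁ f φ)
    Mod  : Obj Sig → Category ℓ
    Mod₁ : ∀ {Σ Σ'} → Hom Sig Σ Σ' → Functor (Mod Σ') (Mod Σ)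
    Mod-id : ∀ {Σ} → Mod₁ (id Sig {Σ}) ≈F IdF (Mod Σ)
    Mod-∘  : ∀ {Σ₁ Σ₂ Σ₃} (f : Hom Sig Σ₁ Σ₂) (g : Hom Sig Σ₂ Σ₃) →
             Mod₁ (_∘_ Sig g f) ≈F (Mod₁ f ∘F Mod₁ g)
    _⊨_ : ∀ {Σ} → Obj (Mod Σ) → Sen Σ → Set ℓ
    sat-cond : ∀ {Σ Σ'} (h : Hom Sig Σ Σ') (M' : Obj (Mod Σ')) (φ : Sen Σ) →
               (M' ⊨ Sen₁ h φ) ⇔ (F₀ (Mod₁ h) M' ⊨ φ)

  _↾_ : ∀ {Σ Σ'} → Obj (Mod Σ') → Hom Sig Σ Σ' → Obj (Mod Σ)
  M ↾ h = F₀ (Mod₁ h) M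

  SameTheory : ∀ {Σ} → Obj (Mod Σ) → Obj (Mod Σ) → Set ℓ
  SameTheory {Σ} M N = ∀ (φ : Sen Σ) → (M ⊨ φ) ⇔ (N ⊨ φ)

  SameModels : ∀ {Σ} → Sen Σ → Sen Σ → Set ℓ
  SameModels {Σ} φ ψ = ∀ (M : Obj (Mod Σ)) → (M ⊨ φ) ⇔ (M ⊨ ψ)

  -- Grothendieck category Mod^♯ : arrows (f , u) : (Σ , M) → (Σ' , N)
  GArr : (Σ Σ' : Obj Sig) → Obj (Mod Σ) → Obj (Mod Σ') → Set ℓ
  GArr Σ Σ' M N = Σ[ f ∈ Hom Sig Σ Σ' ] Hom (Mod Σ) M (N ↾ f)

  G-id : ∀ {Σ} (M : Obj (Mod Σ)) → GArr Σ Σ M M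
  G-id {Σ} M = id Sig , subst (Hom (Mod Σ) M) (sym (obj-eq Mod-id M)) (id (Mod Σ))

  G-∘ : ∀ {Σ₁ Σ₂ Σ₃} {M : Obj (Mod Σ₁)} {N : Obj (Mod Σ₂)} {P : Obj (Mod Σ₃)} →
        GArr Σ₂ Σ₃ N P → GArr Σ₁ Σ₂ M N → GArr Σ₁ Σ₃ M P
  G-∘ {Σ₁} {M = M} {P = P} (g , v) (f , u) =
    _∘_ Sig g f ,
    subst (Hom (Mod Σ₁) M) (sym (obj-eq (Mod-∘ f g) P))
          (_∘_ (Mod Σ₁) (F₁ (Mod₁ f) v) u)

  SenSet : Obj Sig → Set (lsuc ℓ)
  SenSet Σ = Sen Σ → Set ℓ

  PresMor : ∀ {Σ Σ'} → SenSet Σ → SenSet Σ' → Hom Sig Σ Σ' → Set ℓ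
  PresMor E E' f = ∀ φ → E φ → E' (Sen₁ f φ)

  -- arrows of (Mod^Pres)^♯ : ((Σ,E),M) → ((Σ',E'),N);
  -- Mod^Pres(Σ,E) is a full subcategory of Mod(Σ) with inherited reducts,
  -- so such an arrow is an arrow of Mod^♯ whose signature part is a
  -- presentation morphism (equality of arrows = equality of the Mod^♯ part).
  PGArr : ∀ {Σ Σ'} → SenSet Σ → SenSet Σ' → Obj (Mod Σ) → Obj (Mod Σ') → Set ℓ
  PGArr {Σ} {Σ'} E E' M N = Σ[ a ∈ GArr Σ Σ' M N ] PresMor E E' (proj₁ a)

open Institution public

-- Skolemizations.  The record is indexed by the skolem-signature map
-- Σ ↦ Σ_S (which the presentation (Σ_S , S_Σ) depends on only through Σ).

record Skolemization {ℓ} (I : Institution ℓ) (ΣS : Obj (Sig I) → Obj (Sig I)) : Set (lsuc ℓ) where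
  field
    SAx  : ∀ Σ → SenSet I (ΣS Σ)
    -- object part of S : (Σ , M) ↦ ((Σ_S , S_Σ) , M_{SΣ})
    modS : ∀ {Σ} → Obj (Mod I Σ) → Obj (Mod I (ΣS Σ))
    modS-sat : ∀ {Σ} (M : Obj (Mod I Σ)) (φ : Sen I (ΣS Σ)) → SAx Σ φ → _⊨_ I (modS M) φ
    S₁ : ∀ {Σ Σ'} {M : Obj (Mod I Σ)} {N : Obj (Mod I Σ')} →
         GArr I Σ Σ' M N → PGArr I (SAx Σ) (SAx Σ') (modS M) (modS N)
    S-id : ∀ {Σ} (M : Obj (Mod I Σ)) → proj₁ (S₁ (G-id I M)) ≡ G-id I (modS M)
    S-∘  : ∀ {Σ₁ Σ₂ Σ₃} {M : Obj (Mod I Σ₁)} {N : Obj (Mod I Σ₂)} {P : Obj (Mod I Σ₃)}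
           (a : GArr I Σ₁ Σ₂ M N) (b : GArr I Σ₂ Σ₃ N P) →
           proj₁ (S₁ (G-∘ I b a)) ≡ G-∘ I (proj₁ (S₁ b)) (proj₁ (S₁ a))
    τ : ∀ Σ → Hom (Sig I) Σ (ΣS Σ)
    τ-red : ∀ {Σ} (M : Obj (Mod I Σ)) → _↾_ I (modS M) (τ Σ) ≡ M
    incl : ∀ Σ → InclusionSystem (Mod I (ΣS Σ))

  IsSkolemOf : ∀ {Σ} → Obj (Mod I Σ) → Obj (Mod I (ΣS Σ)) → Set ℓ
  IsSkolemOf {Σ} M M' = (_↾_ I M' (τ Σ) ≡ M) × (∀ φ → SAx Σ φ → _⊨_ I M' φ)

  field
    incl-cond : ∀ {Σ} (M N : Obj (Mod I Σ)) (M' N' : Obj (Mod I (ΣS Σ))) →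
                IsSkolemOf M M' → IsSkolemOf N N' →
                (u : Hom (Mod I (ΣS Σ)) M' N') → isU (incl Σ) u →
                SameTheory I M N
open Skolemization public

record InstMorphism {ℓ} (J I : Institution ℓ) : Set (lsuc ℓ) where
  field
    φ : Functor (Sig J) (Sig I)
    α : ∀ Σ → Sen I (F₀ φ Σ) → Sen J Σ
    α-nat : ∀ {Σ Σ'} (h : Hom (Sig J) Σ Σ') (ψ : Sen I (F₀ φ Σ)) →
            α Σ' (Sen₁ I (F₁ φ h) ψ) ≡ Sen₁ J h (α Σ ψ)
    β : ∀ Σ → Functor (Mod J Σ) (Mod I (F₀ φ Σ))
    β-nat : ∀ {Σ Σ'} (h : Hom (Sig J) Σ Σ') →
            (β Σ ∘F Mod₁ J h) ≈F (Mod₁ I (F₁ φ h) ∘F β Σ')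
    sat : ∀ {Σ} (m : Obj (Mod J Σ)) (ψ : Sen I (F₀ φ Σ)) →
          _⊨_ J m (α Σ ψ) ⇔ _⊨_ I (F₀ (β Σ) m) ψ
open InstMorphism public

SemSurjective : ∀ {ℓ} {J I : Institution ℓ} → InstMorphism J I → Set ℓ
SemSurjective {J = J} {I} μ =
  ∀ Σ (ϕ : Sen J Σ) → ∃[ ψ ] SameModels J ϕ (α μ Σ ψ)

-- Let i_Σ : φ(Σ̃) ≅ (φΣ)_S.  The proof assembles a skolemization of J from that of I by
-- moving everything across two isomorphisms:
--   * on signatures, φ is fully faithful, so every I-arrow (φΣ)_S → (φΣ')_S, conjugated
--     by i, has a unique J-preimage Σ̃ → Σ̃' ('Conjugation'); this lift is functorial;
--   * on models, K_Σ = β⁻¹ ∘ Mod(i) : Mod^I((φΣ)_S) → Mod^J(Σ̃) is an isomorphism of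
--     categories, as a composite of two isomorphisms, and it commutes with reducts along
--     lifted arrows.
-- The construction itself ('Construction') takes S'_Σ = α(Sen(i⁻¹)(S_{φΣ})), the skolem
-- model K(M_{S(φΣ)}) of M where M_{S(φΣ)} skolemizes β M, τ'_Σ the preimage of
-- i⁻¹ ∘ τ_{φΣ}, and the inclusion system transported along K; the inclusion condition of I
-- is pulled back to J because β reflects elementary equivalence when α is semantically
-- surjective.
module Submission where

open import Defs
open import Data.Product using (Σ; Σ-syntax; _×_; _,_; proj₁; proj₂)
open import Function.Bundles using (_⇔_; mk⇔; module Equivalence)
open import Function.Properties.Equivalence using () renaming (sym to ⇔-sym; trans to ⇔-trans)
open import Relation.Binary.PropositionalEquality
  using (_≡_; refl; sym; trans; cong; subst; module ≡-Reasoning)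
open Category

module _ {ℓ} (C : Category ℓ) where

  tot-inj : ∀ {A B} {f g : Hom C A B} → tot C f ≡ tot C g → f ≡ g
  tot-inj refl = refl

  tot-subst : ∀ {A B B'} (p : B ≡ B') (h : Hom C A B) → tot C (subst (Hom C A) p h) ≡ tot C h
  tot-subst refl h = refl

  tot-∘ : ∀ {A B D A' B' D'} {f : Hom C A B} {g : Hom C B D} {f' : Hom C A' B'} {g' : Hom C B' D'} →
          tot C f ≡ tot C f' → tot C g ≡ tot C g' → tot C (_∘_ C g f) ≡ tot C (_∘_ C g' f')
  tot-∘ refl refl = refl

  cast : ∀ {A A' B B'} → A ≡ A' → B ≡ B' → Hom C A B → Hom C A' B'
  cast refl refl h = h

  tot-cast : ∀ {A A' B B'} (p : A ≡ A') (q : B ≡ B') (h : Hom C A B) → tot C (cast p q h) ≡ tot C h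
  tot-cast refl refl h = refl

  transP : (P : ArrPred C) {A B A' B' : Obj C} {f : Hom C A B} {g : Hom C A' B'} →
           tot C f ≡ tot C g → P f → P g
  transP P refl x = x

  factorisation-≡ : ∀ {A B Y Y'} {a : Hom C A Y} {b : Hom C Y B} {a' : Hom C A Y'} {b' : Hom C Y' B} →
                    tot C a ≡ tot C a' → tot C b ≡ tot C b' →
                    _≡_ {A = Σ[ Z ∈ Obj C ] (Hom C A Z × Hom C Z B)} (Y , a , b) (Y' , a' , b')
  factorisation-≡ refl refl = refl

totF : ∀ {ℓ} {C D : Category ℓ} (F : Functor C D) {A B A' B'} {f : Hom C A B} {g : Hom C A' B'} →
       tot C f ≡ tot C g → tot D (F₁ F f) ≡ tot D (F₁ F g)
totF F refl = refl

module _ {ℓ} {C D : Category ℓ} where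

  ≈-refl : {F : Functor C D} → F ≈F F
  ≈-refl = record { obj-eq = λ _ → refl ; arr-eq = λ _ → refl }

  ≈-sym : {F G : Functor C D} → F ≈F G → G ≈F F
  ≈-sym p = record { obj-eq = λ A → sym (obj-eq p A) ; arr-eq = λ f → sym (arr-eq p f) }

  ≈-trans : {F G H : Functor C D} → F ≈F G → G ≈F H → F ≈F H
  ≈-trans p q = record { obj-eq = λ A → trans (obj-eq p A) (obj-eq q A)
                       ; arr-eq = λ f → trans (arr-eq p f) (arr-eq q f) }

  infixr 2 _≈⟨_⟩_
  infix 3 _∎F
  _≈⟨_⟩_ : (F : Functor C D) {G H : Functor C D} → F ≈F G → G ≈F H → F ≈F H
  F ≈⟨ p ⟩ q = ≈-trans p q
  _∎F : (F : Functor C D) → F ≈F F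
  F ∎F = ≈-refl

  ∘F-identityˡ : (F : Functor C D) → (IdF D ∘F F) ≈F F
  ∘F-identityˡ F = record { obj-eq = λ _ → refl ; arr-eq = λ _ → refl }

  ∘F-identityʳ : (F : Functor C D) → (F ∘F IdF C) ≈F F
  ∘F-identityʳ F = record { obj-eq = λ _ → refl ; arr-eq = λ _ → refl }

∘F-assoc : ∀ {ℓ} {A B C D : Category ℓ} (F : Functor C D) (G : Functor B C) (H : Functor A B) →
           ((F ∘F G) ∘F H) ≈F (F ∘F (G ∘F H))
∘F-assoc F G H = record { obj-eq = λ _ → refl ; arr-eq = λ _ → refl }

infixl 5 _◂_
infixr 5 _▸_

_◂_ : ∀ {ℓ} {C D E : Category ℓ} {F F' : Functor D E} → F ≈F F' → (G : Functor C D) → (F ∘F G) ≈F (F' ∘F G)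
_◂_ {F = F} p G = record
  { obj-eq = λ A → obj-eq p (F₀ G A)
  ; arr-eq = λ f → arr-eq p (F₁ G f) }

_▸_ : ∀ {ℓ} {C D E : Category ℓ} (F : Functor D E) {G G' : Functor C D} → G ≈F G' → (F ∘F G) ≈F (F ∘F G')
_▸_ F q = record
  { obj-eq = λ A → cong (F₀ F) (obj-eq q A)
  ; arr-eq = λ f → totF F (arr-eq q f) }

module _ {ℓ} {C D : Category ℓ} (F : Functor C D) (G : Functor D C) where

  inverse-sym : IsInverseF F G → IsInverseF G F
  inverse-sym (GF , FG) = FG , GF

  inverse-obj-inj : IsInverseF F G → ∀ {A B} → F₀ F A ≡ F₀ F B → A ≡ B
  inverse-obj-inj (GF , _) {A} {B} e =
    trans (sym (obj-eq GF A)) (trans (cong (F₀ G) e) (obj-eq GF B))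

  inverse-faithful : IsInverseF F G → ∀ {A B} (f g : Hom C A B) → F₁ F f ≡ F₁ F g → f ≡ g
  inverse-faithful (GF , _) f g e =
    tot-inj C (trans (sym (arr-eq GF f)) (trans (cong (λ h → tot C (F₁ G h)) e) (arr-eq GF g)))

inverse-∘ : ∀ {ℓ} {C D E : Category ℓ} {F : Functor C D} {G : Functor D C} {F' : Functor D E} {G' : Functor E D} →
            IsInverseF F G → IsInverseF F' G' → IsInverseF (F' ∘F F) (G ∘F G')
inverse-∘ {F = F} {G} {F'} {G'} (GF , FG) (GF' , FG') =
  ( ((G ∘F G') ∘F (F' ∘F F)     ≈⟨ ∘F-assoc G G' (F' ∘F F) ⟩
     G ∘F (G' ∘F (F' ∘F F))     ≈⟨ G ▸ ≈-sym (∘F-assoc G' F' F) ⟩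
     G ∘F ((G' ∘F F') ∘F F)     ≈⟨ G ▸ (GF' ◂ F) ⟩
     G ∘F (IdF _ ∘F F)          ≈⟨ G ▸ ∘F-identityˡ F ⟩
     G ∘F F                     ≈⟨ GF ⟩
     IdF _ ∎F)
  , ((F' ∘F F) ∘F (G ∘F G')     ≈⟨ ∘F-assoc F' F (G ∘F G') ⟩
     F' ∘F (F ∘F (G ∘F G'))     ≈⟨ F' ▸ ≈-sym (∘F-assoc F G G') ⟩
     F' ∘F ((F ∘F G) ∘F G')     ≈⟨ F' ▸ (FG ◂ G') ⟩
     F' ∘F (IdF _ ∘F G')        ≈⟨ F' ▸ ∘F-identityˡ G' ⟩
     F' ∘F G'                   ≈⟨ FG' ⟩
     IdF _ ∎F) )

inverse-square : ∀ {ℓ} {C C' D D' : Category ℓ} {A : Functor C' C} {B : Functor D' D}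
                 {F : Functor C D} {G : Functor D C} {F' : Functor C' D'} {G' : Functor D' C'} →
                 IsInverseF F G → IsInverseF F' G' →
                 (F ∘F A) ≈F (B ∘F F') → (A ∘F G') ≈F (G ∘F B)
inverse-square {A = A} {B} {F} {G} {F'} {G'} (GF , _) (_ , FG') sq =
  A ∘F G'                   ≈⟨ ≈-sym (∘F-identityˡ (A ∘F G')) ⟩
  IdF _ ∘F (A ∘F G')        ≈⟨ ≈-sym GF ◂ (A ∘F G') ⟩
  (G ∘F F) ∘F (A ∘F G')     ≈⟨ ∘F-assoc G F (A ∘F G') ⟩
  G ∘F (F ∘F (A ∘F G'))     ≈⟨ G ▸ ≈-sym (∘F-assoc F A G') ⟩
  G ∘F ((F ∘F A) ∘F G')     ≈⟨ G ▸ (sq ◂ G') ⟩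
  G ∘F ((B ∘F F') ∘F G')    ≈⟨ G ▸ ∘F-assoc B F' G' ⟩
  G ∘F (B ∘F (F' ∘F G'))    ≈⟨ G ▸ (B ▸ FG') ⟩
  G ∘F (B ∘F IdF _)         ≈⟨ G ▸ ∘F-identityʳ B ⟩
  G ∘F B ∎F

module Transport {ℓ} {C D : Category ℓ} (F : Functor C D) (G : Functor D C)
  (iso : IsInverseF F G) (IS : InclusionSystem C) where

  private
    GF : (G ∘F F) ≈F IdF C
    GF = proj₁ iso
    FG : (F ∘F G) ≈F IdF D
    FG = proj₂ iso
    G-iso : IsInverseF G F
    G-iso = inverse-sym F G iso

  pre : ArrPred C → ArrPred D
  pre P g = P (F₁ G g)

  pre-is-image : (P : ArrPred C) → SameArr {C = D} (pre P) (ImageArr F P)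
  pre-is-image P {A'} {B'} g = mk⇔
    (λ p → F₀ G A' , F₀ G B' , F₁ G g , p , arr-eq FG g)
    (λ { (A , B , f , pf , e) → transP C P (trans (sym (arr-eq GF f)) (totF G e)) pf })

  pre-broad : (P : ArrPred C) → IsBroadSub C P → IsBroadSub D (pre P)
  pre-broad P (P-id , P-∘) =
    (λ {A} → subst P (sym (F-id G {A})) P-id) ,
    (λ {f = f} {g} pf pg → subst P (sym (F-∘ G {f = f} {g = g})) (P-∘ pf pg))

  carry : ∀ {A B} → Σ[ Y ∈ Obj C ] (Hom C (F₀ G A) Y × Hom C Y (F₀ G B)) →
          Σ[ Y ∈ Obj D ] (Hom D A Y × Hom D Y B)
  carry {A} {B} (Y , a , b) =
    F₀ F Y , cast D (obj-eq FG A) refl (F₁ F a) , cast D refl (obj-eq FG B) (F₁ F b)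

  carry-G : ∀ {A B X} (e : Hom D A X) (m : Hom D X B) → carry (F₀ G X , F₁ G e , F₁ G m) ≡ (X , e , m)
  carry-G e m = factorisation-≡ D (trans (tot-cast D _ refl (F₁ F (F₁ G e))) (arr-eq FG e))
                                  (trans (tot-cast D refl _ (F₁ F (F₁ G m))) (arr-eq FG m))

  factor' : ∀ {A B} (f : Hom D A B) →
            Σ[ X ∈ Obj D ] Σ[ e ∈ Hom D A X ] Σ[ m ∈ Hom D X B ]
              (pre (isE IS) e × pre (isU IS) m × _∘_ D m e ≡ f)
  factor' {A} {B} f with factor IS (F₁ G f)
  ... | X , e , m , pe , pm , eq =
    F₀ F X , cast D (obj-eq FG A) refl (F₁ F e) , cast D refl (obj-eq FG B) (F₁ F m) ,
    transP C (isE IS) (sym (back-to e (tot-cast D _ refl (F₁ F e)))) pe ,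
    transP C (isU IS) (sym (back-to m (tot-cast D refl _ (F₁ F m)))) pm ,
    tot-inj D (trans (tot-∘ D (tot-cast D _ refl (F₁ F e)) (tot-cast D refl _ (F₁ F m)))
              (trans (cong (tot D) (sym (F-∘ F)))
              (trans (cong (λ h → tot D (F₁ F h)) eq) (arr-eq FG f))))
    where
    back-to : ∀ {P Q P' Q'} (h : Hom C P Q) {h' : Hom D P' Q'} →
              tot D h' ≡ tot D (F₁ F h) → tot C (F₁ G h') ≡ tot C h
    back-to h p = trans (totF G p) (arr-eq GF h)

  transported : InclusionSystem D
  transported = record
    { isU = pre (isU IS)
    ; isE = pre (isE IS)
    ; U-sub = pre-broad (isU IS) (U-sub IS)
    ; E-sub = pre-broad (isE IS) (E-sub IS)
    ; U-po = (λ f g pf pg → inverse-faithful G F G-iso f g (proj₁ (U-po IS) (F₁ G f) (F₁ G g) pf pg)) ,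
             (λ f g pf pg → inverse-obj-inj G F G-iso (proj₂ (U-po IS) (F₁ G f) (F₁ G g) pf pg))
    ; factor = factor'
    ; factor-unique = λ f X e m pe pm eq X' e' m' pe' pm' eq' →
        trans (sym (carry-G e m))
          (trans (cong carry (factor-unique IS (F₁ G f)
                    (F₀ G X) (F₁ G e) (F₁ G m) pe pm (trans (sym (F-∘ G)) (cong (F₁ G) eq))
                    (F₀ G X') (F₁ G e') (F₁ G m') pe' pm' (trans (sym (F-∘ G)) (cong (F₁ G) eq'))))
                 (carry-G e' m'))
    }

module Conjugation {ℓ} {C D : Category ℓ} (F : Functor C D) (ff : FullyFaithful F)
  {X : Set ℓ} (T : X → Obj C) (Q : X → Obj D) (i : ∀ x → Iso D (F₀ F (T x)) (Q x)) where

  private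
    module C = Category C
    module D = Category D
  open ≡-Reasoning

  lift : ∀ {x y} → D.Hom (Q x) (Q y) → C.Hom (T x) (T y)
  lift {x} {y} g = proj₁ (proj₁ ff (from (i y) D.∘ (g D.∘ to (i x))))

  lift-eq : ∀ {x y} (g : D.Hom (Q x) (Q y)) → F₁ F (lift g) ≡ from (i y) D.∘ (g D.∘ to (i x))
  lift-eq {x} {y} g = proj₂ (proj₁ ff (from (i y) D.∘ (g D.∘ to (i x))))

  to-lift : ∀ {x y} (g : D.Hom (Q x) (Q y)) → to (i y) D.∘ F₁ F (lift g) ≡ g D.∘ to (i x)
  to-lift {x} {y} g = begin
    to (i y) D.∘ F₁ F (lift g)                      ≡⟨ cong (to (i y) D.∘_) (lift-eq g) ⟩
    to (i y) D.∘ (from (i y) D.∘ (g D.∘ to (i x)))  ≡⟨ sym D.assoc ⟩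
    (to (i y) D.∘ from (i y)) D.∘ (g D.∘ to (i x))  ≡⟨ cong (D._∘ (g D.∘ to (i x))) (to∘from (i y)) ⟩
    D.id D.∘ (g D.∘ to (i x))                       ≡⟨ D.identityˡ ⟩
    g D.∘ to (i x)                                  ∎

  lift-from : ∀ {x y} (g : D.Hom (Q x) (Q y)) → F₁ F (lift g) D.∘ from (i x) ≡ from (i y) D.∘ g
  lift-from {x} {y} g = begin
    F₁ F (lift g) D.∘ from (i x)                      ≡⟨ cong (D._∘ from (i x)) (lift-eq g) ⟩
    (from (i y) D.∘ (g D.∘ to (i x))) D.∘ from (i x)  ≡⟨ D.assoc ⟩
    from (i y) D.∘ ((g D.∘ to (i x)) D.∘ from (i x))  ≡⟨ cong (from (i y) D.∘_) D.assoc ⟩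
    from (i y) D.∘ (g D.∘ (to (i x) D.∘ from (i x)))  ≡⟨ cong (λ z → from (i y) D.∘ (g D.∘ z)) (to∘from (i x)) ⟩
    from (i y) D.∘ (g D.∘ D.id)                       ≡⟨ cong (from (i y) D.∘_) D.identityʳ ⟩
    from (i y) D.∘ g                                  ∎

  lift-id : ∀ {x} → lift {x} {x} D.id ≡ C.id
  lift-id {x} = proj₂ ff _ _ (begin
    F₁ F (lift D.id)                  ≡⟨ lift-eq D.id ⟩
    from (i x) D.∘ (D.id D.∘ to (i x)) ≡⟨ cong (from (i x) D.∘_) D.identityˡ ⟩
    from (i x) D.∘ to (i x)           ≡⟨ from∘to (i x) ⟩
    D.id                              ≡⟨ sym (F-id F) ⟩
    F₁ F C.id                         ∎)

  lift-∘ : ∀ {x y z} (g : D.Hom (Q x) (Q y)) (h : D.Hom (Q y) (Q z)) →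
           lift (h D.∘ g) ≡ lift h C.∘ lift g
  lift-∘ {x} {y} {z} g h = proj₂ ff _ _ (begin
    F₁ F (lift (h D.∘ g))                                  ≡⟨ lift-eq (h D.∘ g) ⟩
    from (i z) D.∘ ((h D.∘ g) D.∘ to (i x))                ≡⟨ cong (λ k → from (i z) D.∘ k) D.assoc ⟩
    from (i z) D.∘ (h D.∘ (g D.∘ to (i x)))                ≡⟨ cong (λ k → from (i z) D.∘ (h D.∘ k)) (sym (to-lift g)) ⟩
    from (i z) D.∘ (h D.∘ (to (i y) D.∘ F₁ F (lift g)))    ≡⟨ cong (from (i z) D.∘_) (sym D.assoc) ⟩
    from (i z) D.∘ ((h D.∘ to (i y)) D.∘ F₁ F (lift g))    ≡⟨ sym D.assoc ⟩
    (from (i z) D.∘ (h D.∘ to (i y))) D.∘ F₁ F (lift g)    ≡⟨ cong (D._∘ F₁ F (lift g)) (sym (lift-eq h)) ⟩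
    F₁ F (lift h) D.∘ F₁ F (lift g)                        ≡⟨ sym (F-∘ F) ⟩
    F₁ F (lift h C.∘ lift g)                               ∎)

module _ {ℓ} (I : Institution ℓ) where

  private module S = Category (Sig I)

  Mod-cong : ∀ {Σ Σ'} {f g : S.Hom Σ Σ'} → f ≡ g → Mod₁ I f ≈F Mod₁ I g
  Mod-cong refl = ≈-refl

  Mod-square : ∀ {Σ₁ Σ₂ Σ₃ Σ₄} {a : S.Hom Σ₁ Σ₂} {f' : S.Hom Σ₂ Σ₄} {f : S.Hom Σ₁ Σ₃} {b : S.Hom Σ₃ Σ₄} →
               f' S.∘ a ≡ b S.∘ f → (Mod₁ I a ∘F Mod₁ I f') ≈F (Mod₁ I f ∘F Mod₁ I b)
  Mod-square {a = a} {f'} {f} {b} sq =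
    ≈-trans (≈-sym (Mod-∘ I a f')) (≈-trans (Mod-cong sq) (Mod-∘ I f b))

  Mod-section : ∀ {Σ Σ'} {f : S.Hom Σ Σ'} {g : S.Hom Σ' Σ} → g S.∘ f ≡ S.id →
                (Mod₁ I f ∘F Mod₁ I g) ≈F IdF (Mod I Σ)
  Mod-section {f = f} {g} gf = ≈-trans (≈-sym (Mod-∘ I f g)) (≈-trans (Mod-cong gf) (Mod-id I))

  Mod-iso : ∀ {Σ Σ'} (j : Iso (Sig I) Σ Σ') → IsInverseF (Mod₁ I (to j)) (Mod₁ I (from j))
  Mod-iso j = Mod-section (to∘from j) , Mod-section (from∘to j)

  GArr-ext : ∀ {Σ Σ' M N} {f f' : S.Hom Σ Σ'}
             {u : Hom (Mod I Σ) M (_↾_ I N f)} {u' : Hom (Mod I Σ) M (_↾_ I N f')} →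
             f ≡ f' → tot (Mod I Σ) u ≡ tot (Mod I Σ) u' → _≡_ {A = GArr I Σ Σ' M N} (f , u) (f' , u')
  GArr-ext {Σ} refl q = cong (_ ,_) (tot-inj (Mod I Σ) q)

module GrothendieckMap {ℓ} (A B : Institution ℓ) {X : Set ℓ}
  (s : X → Obj (Sig A)) (t : X → Obj (Sig B))
  (H : ∀ {x y} → Hom (Sig A) (s x) (s y) → Hom (Sig B) (t x) (t y))
  (H-id : ∀ {x} → H (id (Sig A) {s x}) ≡ id (Sig B))
  (H-∘ : ∀ {x y z} (g : Hom (Sig A) (s x) (s y)) (h : Hom (Sig A) (s y) (s z)) →
         H (_∘_ (Sig A) h g) ≡ _∘_ (Sig B) (H h) (H g))
  (M : ∀ x → Functor (Mod A (s x)) (Mod B (t x)))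
  (M-nat : ∀ {x y} (g : Hom (Sig A) (s x) (s y)) → (Mod₁ B (H g) ∘F M y) ≈F (M x ∘F Mod₁ A g))
  where

  map : ∀ {x y} {m : Obj (Mod A (s x))} {n : Obj (Mod A (s y))} →
        GArr A (s x) (s y) m n → GArr B (t x) (t y) (F₀ (M x) m) (F₀ (M y) n)
  map {x} {m = m} {n} (g , v) =
    H g , subst (Hom (Mod B (t x)) (F₀ (M x) m)) (sym (obj-eq (M-nat g) n)) (F₁ (M x) v)

  map-id : ∀ {x} (m : Obj (Mod A (s x))) → map (G-id A m) ≡ G-id B (F₀ (M x) m)
  map-id {x} m = GArr-ext B H-id
    (trans (tot-subst (Mod B (t x)) _ _)
    (trans (totF (M x) (tot-subst (Mod A (s x)) _ _))
    (trans (cong (tot (Mod B (t x))) (F-id (M x)))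
           (sym (tot-subst (Mod B (t x)) _ _)))))

  -- Stripping the casts, M(Mod(g)(w) ∘ v) = Mod(H g)(M w) ∘ M v by functoriality of M and
  -- naturality M ∘ Mod(g) ≈ Mod(H g) ∘ M.
  map-∘ : ∀ {x y z} {m : Obj (Mod A (s x))} {n : Obj (Mod A (s y))} {p : Obj (Mod A (s z))}
          (a : GArr A (s x) (s y) m n) (b : GArr A (s y) (s z) n p) →
          map (G-∘ A b a) ≡ G-∘ B (map b) (map a)
  map-∘ {x} {y} (g , v) (h , w) = GArr-ext B (H-∘ g h)
    (trans (tot-subst (Mod B (t x)) _ _)
    (trans (totF (M x) (tot-subst (Mod A (s x)) _ _))
    (trans (cong (tot (Mod B (t x))) (F-∘ (M x)))
    (trans (tot-∘ (Mod B (t x)) (sym (tot-subst (Mod B (t x)) _ _))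
              (sym (trans (totF (Mod₁ B (H g)) (tot-subst (Mod B (t y)) _ _)) (arr-eq (M-nat g) w))))
           (sym (tot-subst (Mod B (t x)) _ _))))))

module _ {ℓ} {J I : Institution ℓ} (μ : InstMorphism J I) where

  sat-along : ∀ {Σ₀ Σ} (h : Hom (Sig I) Σ₀ (F₀ (φ μ) Σ)) (m : Obj (Mod J Σ)) (ψ : Sen I Σ₀) →
              _⊨_ J m (α μ Σ (Sen₁ I h ψ)) ⇔ _⊨_ I (_↾_ I (F₀ (β μ Σ) m) h) ψ
  sat-along h m ψ = ⇔-trans (sat μ m (Sen₁ I h ψ)) (sat-cond I h (F₀ (β μ _) m) ψ)

  reflect-SameTheory : SemSurjective μ → ∀ {Σ} (M N : Obj (Mod J Σ)) →
                       SameTheory I (F₀ (β μ Σ) M) (F₀ (β μ Σ) N) → SameTheory J M N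
  reflect-SameTheory ss {Σ} M N same ϕ with ss Σ ϕ
  ... | ψ , sm =
    ⇔-trans (sm M) (⇔-trans (sat μ M ψ) (⇔-trans (same ψ) (⇔-trans (⇔-sym (sat μ N ψ)) (⇔-sym (sm N)))))

module Construction {ℓ} (I J : Institution ℓ)
    (ΣS : Obj (Sig I) → Obj (Sig I)) (Sk : Skolemization I ΣS)
    (μ : InstMorphism J I)
    (ff : FullyFaithful (φ μ))
    (tilde : Obj (Sig J) → Obj (Sig J))
    (i : ∀ Σ → Iso (Sig I) (F₀ (φ μ) (tilde Σ)) (ΣS (F₀ (φ μ) Σ)))
    (βinv : ∀ Σ → Functor (Mod I (F₀ (φ μ) Σ)) (Mod J Σ))
    (inv : ∀ Σ → IsInverseF (β μ Σ) (βinv Σ))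
    (ss : SemSurjective μ) where

  private
    module SI = Category (Sig I)
    module SJ = Category (Sig J)
  open ≡-Reasoning

  Φ : Functor (Sig J) (Sig I)
  Φ = φ μ

  -- φΣ, its skolem signature (φΣ)_S, and the J-signature Σ̃ representing it.
  P : Obj (Sig J) → Obj (Sig I)
  P Σ = F₀ Φ Σ
  Q : Obj (Sig J) → Obj (Sig I)
  Q Σ = ΣS (P Σ)
  T : Obj (Sig J) → Obj (Sig J)
  T = tilde

  ι : ∀ Σ → SI.Hom (P (T Σ)) (Q Σ)
  ι Σ = to (i Σ)
  ι⁻¹ : ∀ Σ → SI.Hom (Q Σ) (P (T Σ))
  ι⁻¹ Σ = from (i Σ)

  open Conjugation Φ ff T Q i using (lift; lift-id; lift-∘; to-lift; lift-from)

  K : ∀ Σ → Functor (Mod I (Q Σ)) (Mod J (T Σ))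
  K Σ = βinv (T Σ) ∘F Mod₁ I (ι Σ)
  L : ∀ Σ → Functor (Mod J (T Σ)) (Mod I (Q Σ))
  L Σ = Mod₁ I (ι⁻¹ Σ) ∘F β μ (T Σ)

  K-iso : ∀ Σ → IsInverseF (K Σ) (L Σ)
  K-iso Σ = inverse-∘ {F = Mod₁ I (ι Σ)} {G = Mod₁ I (ι⁻¹ Σ)} {F' = βinv (T Σ)} {G' = β μ (T Σ)}
                      (Mod-iso I (i Σ)) (inverse-sym (β μ (T Σ)) (βinv (T Σ)) (inv (T Σ)))

  -- β⁻¹ commutes with reducts, being inverse to the natural β.
  βinv-nat : ∀ {Σ Σ'} (h : SJ.Hom Σ Σ') → (Mod₁ J h ∘F βinv Σ') ≈F (βinv Σ ∘F Mod₁ I (F₁ Φ h))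
  βinv-nat {Σ} {Σ'} h =
    inverse-square {A = Mod₁ J h} {B = Mod₁ I (F₁ Φ h)} {F = β μ Σ} {G = βinv Σ} {F' = β μ Σ'} {G' = βinv Σ'}
                   (inv Σ) (inv Σ') (β-nat μ h)

  K-nat : ∀ {Σ Σ'} (g : SI.Hom (Q Σ) (Q Σ')) → (Mod₁ J (lift g) ∘F K Σ') ≈F (K Σ ∘F Mod₁ I g)
  K-nat {Σ} {Σ'} g =
    Mod₁ J (lift g) ∘F K Σ'                                 ≈⟨ ≈-sym (∘F-assoc (Mod₁ J (lift g)) (βinv (T Σ')) (Mod₁ I (ι Σ'))) ⟩
    (Mod₁ J (lift g) ∘F βinv (T Σ')) ∘F Mod₁ I (ι Σ')       ≈⟨ βinv-nat (lift g) ◂ Mod₁ I (ι Σ') ⟩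
    (βinv (T Σ) ∘F Mod₁ I (F₁ Φ (lift g))) ∘F Mod₁ I (ι Σ') ≈⟨ ∘F-assoc (βinv (T Σ)) (Mod₁ I (F₁ Φ (lift g))) (Mod₁ I (ι Σ')) ⟩
    βinv (T Σ) ∘F (Mod₁ I (F₁ Φ (lift g)) ∘F Mod₁ I (ι Σ')) ≈⟨ βinv (T Σ) ▸ Mod-square I (to-lift g) ⟩
    βinv (T Σ) ∘F (Mod₁ I (ι Σ) ∘F Mod₁ I g)                ≈⟨ ≈-sym (∘F-assoc (βinv (T Σ)) (Mod₁ I (ι Σ)) (Mod₁ I g)) ⟩
    K Σ ∘F Mod₁ I g ∎F

  -- Model morphisms of J are sent to I by (φ, β), and those between skolem models back by (lift, K).
  module Fwd = GrothendieckMap J I (λ Σ → Σ) P (F₁ Φ) (F-id Φ) (λ _ _ → F-∘ Φ)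
                 (β μ) (λ h → ≈-sym (β-nat μ h))
  module Bwd = GrothendieckMap I J Q T lift lift-id lift-∘ K K-nat

  SAx' : ∀ Σ → SenSet J (T Σ)
  SAx' Σ ϕ = Σ[ ψ ∈ Sen I (Q Σ) ] (SAx Sk (P Σ) ψ × ϕ ≡ α μ (T Σ) (Sen₁ I (ι⁻¹ Σ) ψ))

  modS' : ∀ {Σ} → Obj (Mod J Σ) → Obj (Mod J (T Σ))
  modS' {Σ} M = F₀ (K Σ) (modS Sk (F₀ (β μ Σ) M))

  modS-sat' : ∀ {Σ} (M : Obj (Mod J Σ)) (ϕ : Sen J (T Σ)) → SAx' Σ ϕ → _⊨_ J (modS' M) ϕ
  modS-sat' {Σ} M _ (ψ , s , refl) =
    Equivalence.from (sat-along μ (ι⁻¹ Σ) (modS' M) ψ)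
      (subst (λ Z → _⊨_ I Z ψ) (sym (obj-eq (proj₁ (K-iso Σ)) (modS Sk (F₀ (β μ Σ) M))))
             (modS-sat Sk (F₀ (β μ Σ) M) ψ s))

  pres : ∀ {Σ Σ'} (g : SI.Hom (Q Σ) (Q Σ')) → PresMor I (SAx Sk (P Σ)) (SAx Sk (P Σ')) g →
         PresMor J (SAx' Σ) (SAx' Σ') (lift g)
  pres {Σ} {Σ'} g pg _ (ψ , s , refl) = Sen₁ I g ψ , pg ψ s , (begin
    Sen₁ J (lift g) (α μ (T Σ) (Sen₁ I (ι⁻¹ Σ) ψ))        ≡⟨ sym (α-nat μ (lift g) _) ⟩
    α μ (T Σ') (Sen₁ I (F₁ Φ (lift g)) (Sen₁ I (ι⁻¹ Σ) ψ)) ≡⟨ cong (α μ (T Σ')) (sym (Sen-∘ I (ι⁻¹ Σ) (F₁ Φ (lift g)) ψ)) ⟩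
    α μ (T Σ') (Sen₁ I (F₁ Φ (lift g) SI.∘ ι⁻¹ Σ) ψ)       ≡⟨ cong (λ z → α μ (T Σ') (Sen₁ I z ψ)) (lift-from g) ⟩
    α μ (T Σ') (Sen₁ I (ι⁻¹ Σ' SI.∘ g) ψ)                 ≡⟨ cong (α μ (T Σ')) (Sen-∘ I g (ι⁻¹ Σ') ψ) ⟩
    α μ (T Σ') (Sen₁ I (ι⁻¹ Σ') (Sen₁ I g ψ))              ∎)

  S₁' : ∀ {Σ Σ'} {M : Obj (Mod J Σ)} {N : Obj (Mod J Σ')} →
        GArr J Σ Σ' M N → PGArr J (SAx' Σ) (SAx' Σ') (modS' M) (modS' N)
  S₁' a = Bwd.map (proj₁ (S₁ Sk (Fwd.map a))) , pres _ (proj₂ (S₁ Sk (Fwd.map a)))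

  S-id' : ∀ {Σ} (M : Obj (Mod J Σ)) → proj₁ (S₁' (G-id J M)) ≡ G-id J (modS' M)
  S-id' {Σ} M = begin
    Bwd.map (proj₁ (S₁ Sk (Fwd.map (G-id J M))))       ≡⟨ cong (λ a → Bwd.map (proj₁ (S₁ Sk a))) (Fwd.map-id M) ⟩
    Bwd.map (proj₁ (S₁ Sk (G-id I (F₀ (β μ Σ) M))))    ≡⟨ cong Bwd.map (S-id Sk (F₀ (β μ Σ) M)) ⟩
    Bwd.map (G-id I (modS Sk (F₀ (β μ Σ) M)))          ≡⟨ Bwd.map-id (modS Sk (F₀ (β μ Σ) M)) ⟩
    G-id J (modS' M)                                    ∎

  S-∘' : ∀ {Σ₁ Σ₂ Σ₃} {M : Obj (Mod J Σ₁)} {N : Obj (Mod J Σ₂)} {R : Obj (Mod J Σ₃)}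
         (a : GArr J Σ₁ Σ₂ M N) (b : GArr J Σ₂ Σ₃ N R) →
         proj₁ (S₁' (G-∘ J b a)) ≡ G-∘ J (proj₁ (S₁' b)) (proj₁ (S₁' a))
  S-∘' a b = begin
    Bwd.map (proj₁ (S₁ Sk (Fwd.map (G-∘ J b a))))                    ≡⟨ cong (λ c → Bwd.map (proj₁ (S₁ Sk c))) (Fwd.map-∘ a b) ⟩
    Bwd.map (proj₁ (S₁ Sk (G-∘ I (Fwd.map b) (Fwd.map a))))          ≡⟨ cong Bwd.map (S-∘ Sk (Fwd.map a) (Fwd.map b)) ⟩
    Bwd.map (G-∘ I (proj₁ (S₁ Sk (Fwd.map b))) (proj₁ (S₁ Sk (Fwd.map a))))
      ≡⟨ Bwd.map-∘ (proj₁ (S₁ Sk (Fwd.map a))) (proj₁ (S₁ Sk (Fwd.map b))) ⟩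
    G-∘ J (proj₁ (S₁' b)) (proj₁ (S₁' a))                            ∎

  τ' : ∀ Σ → SJ.Hom Σ (T Σ)
  τ' Σ = proj₁ (proj₁ ff (ι⁻¹ Σ SI.∘ τ Sk (P Σ)))

  τ'-eq : ∀ Σ → F₁ Φ (τ' Σ) ≡ ι⁻¹ Σ SI.∘ τ Sk (P Σ)
  τ'-eq Σ = proj₂ (proj₁ ff (ι⁻¹ Σ SI.∘ τ Sk (P Σ)))

  L-reduct : ∀ {Σ} (M' : Obj (Mod J (T Σ))) → _↾_ I (F₀ (L Σ) M') (τ Sk (P Σ)) ≡ F₀ (β μ Σ) (_↾_ J M' (τ' Σ))
  L-reduct {Σ} M' = begin
    F₀ (Mod₁ I (τ Sk (P Σ))) (F₀ (Mod₁ I (ι⁻¹ Σ)) (F₀ (β μ (T Σ)) M')) ≡⟨ sym (obj-eq (Mod-∘ I (τ Sk (P Σ)) (ι⁻¹ Σ)) _) ⟩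
    F₀ (Mod₁ I (ι⁻¹ Σ SI.∘ τ Sk (P Σ))) (F₀ (β μ (T Σ)) M')           ≡⟨ cong (λ z → F₀ (Mod₁ I z) (F₀ (β μ (T Σ)) M')) (sym (τ'-eq Σ)) ⟩
    F₀ (Mod₁ I (F₁ Φ (τ' Σ))) (F₀ (β μ (T Σ)) M')                     ≡⟨ sym (obj-eq (β-nat μ (τ' Σ)) M') ⟩
    F₀ (β μ Σ) (_↾_ J M' (τ' Σ))                                      ∎

  τ-red' : ∀ {Σ} (M : Obj (Mod J Σ)) → _↾_ J (modS' M) (τ' Σ) ≡ M
  τ-red' {Σ} M = inverse-obj-inj (β μ Σ) (βinv Σ) (inv Σ) (begin
    F₀ (β μ Σ) (_↾_ J (modS' M) (τ' Σ))        ≡⟨ sym (L-reduct (modS' M)) ⟩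
    _↾_ I (F₀ (L Σ) (modS' M)) (τ Sk (P Σ))    ≡⟨ cong (λ z → _↾_ I z (τ Sk (P Σ))) (obj-eq (proj₁ (K-iso Σ)) _) ⟩
    _↾_ I (modS Sk (F₀ (β μ Σ) M)) (τ Sk (P Σ)) ≡⟨ τ-red Sk (F₀ (β μ Σ) M) ⟩
    F₀ (β μ Σ) M                                ∎)

  incl' : ∀ Σ → InclusionSystem (Mod J (T Σ))
  incl' Σ = Transport.transported (K Σ) (L Σ) (K-iso Σ) (incl Sk (P Σ))

  L-skolem : ∀ {Σ} (M : Obj (Mod J Σ)) (M' : Obj (Mod J (T Σ))) →
             _↾_ J M' (τ' Σ) ≡ M → (∀ ϕ → SAx' Σ ϕ → _⊨_ J M' ϕ) →
             IsSkolemOf Sk (F₀ (β μ Σ) M) (F₀ (L Σ) M')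
  L-skolem {Σ} M M' red sat' =
    trans (L-reduct M') (cong (F₀ (β μ Σ)) red) ,
    λ ψ s → Equivalence.to (sat-along μ (ι⁻¹ Σ) M' ψ) (sat' _ (ψ , s , refl))

  Sk' : Skolemization J tilde
  Sk' = record
    { SAx = SAx'
    ; modS = modS'
    ; modS-sat = modS-sat'
    ; S₁ = S₁'
    ; S-id = S-id'
    ; S-∘ = S-∘'
    ; τ = τ'
    ; τ-red = τ-red'
    ; incl = incl'
    ; incl-cond = λ {Σ} M N M' N' (rM , sM) (rN , sN) u uU →
        reflect-SameTheory μ ss M N
          (incl-cond Sk (F₀ (β μ Σ) M) (F₀ (β μ Σ) N) (F₀ (L Σ) M') (F₀ (L Σ) N')
                     (L-skolem M M' rM sM) (L-skolem N N' rN sN) (F₁ (L Σ) u) uU)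
    }

theorem14 : ∀ {ℓ} (I J : Institution ℓ)
    (ΣS : Category.Obj (Sig I) → Category.Obj (Sig I)) (Sk : Skolemization I ΣS)
    (μ : InstMorphism J I) →
    FullyFaithful (φ μ) →
    (tilde : Category.Obj (Sig J) → Category.Obj (Sig J)) →
    (i : ∀ Σ → Iso (Sig I) (F₀ (φ μ) (tilde Σ)) (ΣS (F₀ (φ μ) Σ))) →
    (βinv : ∀ Σ → Functor (Mod I (F₀ (φ μ) Σ)) (Mod J Σ)) →
    (∀ Σ → IsInverseF (β μ Σ) (βinv Σ)) →
    SemSurjective μ →
    Σ[ Sk' ∈ Skolemization J tilde ]
      ((∀ Σ → F₁ (φ μ) (τ Sk' Σ)
                ≡ Category._∘_ (Sig I) (from (i Σ)) (τ Sk (F₀ (φ μ) Σ))) ×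
       (∀ Σ → SameArr {C = Mod J (tilde Σ)} (isU (incl Sk' Σ))
                (ImageArr {C = Mod I (ΣS (F₀ (φ μ) Σ))} {D = Mod J (tilde Σ)} (βinv (tilde Σ) ∘F Mod₁ I (to (i Σ))) (isU (incl Sk (F₀ (φ μ) Σ))))
            × SameArr {C = Mod J (tilde Σ)} (isE (incl Sk' Σ))
                (ImageArr {C = Mod I (ΣS (F₀ (φ μ) Σ))} {D = Mod J (tilde Σ)} (βinv (tilde Σ) ∘F Mod₁ I (to (i Σ))) (isE (incl Sk (F₀ (φ μ) Σ))))))
theorem14 I J ΣS Sk μ ff tilde i βinv inv ss =
  Sk' , τ'-eq , λ Σ → image Σ (isU (incl Sk (P Σ))) , image Σ (isE (incl Sk (P Σ)))
  where
  open Construction I J ΣS Sk μ ff tilde i βinv inv ss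
  image : ∀ Σ (Pr : ArrPred (Mod I (Q Σ))) →
          SameArr {C = Mod J (T Σ)} (Transport.pre (K Σ) (L Σ) (K-iso Σ) (incl Sk (P Σ)) Pr) (ImageArr (K Σ) Pr)
  image Σ = Transport.pre-is-image (K Σ) (L Σ) (K-iso Σ) (incl Sk (P Σ))
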